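{- For any multigraph $G$ on $n$ vertices, $P(G,m)-P_{DP}(G,m)=O(m^{n-1})$ as $m\to\infty$.
   Context: All graphs are finite, nonempty, loopless multigraphs. $P(G,m)$ is the number of proper colorings of $G$ with colors from $[m]$ (adjacent vertices get different colors). For $u,v\in V(G)$, $E_G(u,v)$ is the set of edges joining $u,v$ and $e_G(u,v)=|E_G(u,v)|$. A cover of $G$ is a triple $\mathcal{H}=(L,H,M)$: $L$ assigns to each vertex a nonempty finite set, $H$ is a multigraph on $\bigcup_x L(x)$, $M$ assigns to each edge $e$ (with endpoints $u,v$) a matching $M(e)$ of $H$ whose edges go between $L(u)$ and $L(v)$, such that the $L(x)$ are pairwise disjoint, each $H[L(x)]$ is complete, $M(e_1)\cap M(e_2)=\emptyset$ for distinct edges, and for distinct $u,v$ the edges of $H$ between $L(u)$ and $L(v)$ are exactly $\bigcup_{e\in E_G(u,v)}M(e)$. It is a full $m$-fold cover if $|L(x)|=m$ for all $x$ and there are exactly $e_G(u,v)m$ edges of $H$ between $L(u)$ and $L(v)$ for all distinct $u,v$. An $\mathcal{H}$-coloring is an independent set of $H$ of size $|V(G)|$; $P_{DP}(G,\mathcal{H})$ is their number; $P_{DP}(G,m)$ is the minimum of $P_{DP}(G,\mathcal{H})$ over all full $m$-fold covers $\mathcal{H}$ of $G$. -}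

module Defs where

open import Data.Nat using (ℕ; zero; suc; _⊓_)
open import Data.Fin using (Fin; zero; suc)
open import Data.Fin.Properties using (_≟_)
open import Data.List using (List; []; _∷_; length; filter; map; concatMap; allFin)
open import Data.List.Relation.Unary.All using (All)
open import Data.Vec using (Vec; []; _∷_; lookup; toList)
open import Data.Product using (_×_; _,_; proj₁; proj₂)
open import Relation.Binary.PropositionalEquality using (_≡_; _≢_)
open import Relation.Nullary using (¬_; Dec; ¬?; yes)
open import Relation.Nullary.Decidable using (_×-dec_)
open import Data.Unit using (⊤; tt)
open import Relation.Unary using (Decidable)
import Data.List.Relation.Unary.All as All
open import Data.List.Relation.Unary.AllPairs using (AllPairs; allPairs?)

-- A finite loopless multigraph on the vertex set Fin n, given by its list of
-- edges (parallel edges = repeated entries; each entry (u , v) is one edge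
-- joining u and v).
record Multigraph (n : ℕ) : Set where
  field
    edges    : List (Fin n × Fin n)
    loopless : All (λ e → proj₁ e ≢ proj₂ e) edges
open Multigraph public

allVecs : (m n : ℕ) → List (Vec (Fin m) n)
allVecs m zero    = [] ∷ []
allVecs m (suc n) = concatMap (λ x → map (x ∷_) (allVecs m n)) (allFin m)

count : ∀ {A : Set} {P : A → Set} → Decidable P → List A → ℕ
count P? xs = length (filter P? xs)

-- minimum of a list of naturals (the lists used below are never empty)
minList : List ℕ → ℕ
minList []           = 0
minList (x ∷ [])     = x
minList (x ∷ y ∷ xs) = x ⊓ minList (y ∷ xs)

Proper : ∀ {n m} → Multigraph n → Vec (Fin m) n → Set
Proper G c = All (λ e → ¬ (lookup c (proj₁ e) ≡ lookup c (proj₂ e))) (edges G)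

proper? : ∀ {n m} (G : Multigraph n) → Decidable (Proper {n} {m} G)
proper? G c = All.all? (λ e → ¬? (lookup c (proj₁ e) ≟ lookup c (proj₂ e))) (edges G)

P : ∀ {n} → Multigraph n → ℕ → ℕ
P {n} G m = count (proper? G) (allVecs m n)

IsPerm : ∀ {m} → Vec (Fin m) m → Set
IsPerm p = AllPairs (λ x y → x ≢ y) (toList p)

isPerm? : ∀ {m} → Decidable (IsPerm {m})
isPerm? p = allPairs? (λ x y → ¬? (x ≟ y)) (toList p)

perms : (m : ℕ) → List (Vec (Fin m) m)
perms m = filter isPerm? (allVecs m m)

-- A full m-fold cover of G (with L(x) = {x} × Fin m) is determined by
-- choosing, for each edge e = (u , v) of G, the perfect matching M(e)
-- between L(u) and L(v), i.e. a permutation σ_e with (u,i) ~ (v, σ_e i).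
-- It is stored as a list of permutations, one per edge (same order).
Cover : ℕ → ℕ → Set
Cover k m = Vec (Vec (Fin m) m) k

allCovers : (k m : ℕ) → List (Cover k m)
allCovers zero    m = [] ∷ []
allCovers (suc k) m = concatMap (λ σ → map (σ ∷_) (allCovers k m)) (perms m)

-- An H-coloring (independent set of size n in H) picks exactly one color
-- c x ∈ L(x) per vertex (L(x) is a clique) with no matching edge between
-- the chosen colors.
CoverOK : ∀ {n m} → List (Fin n × Fin n) → List (Vec (Fin m) m) → Vec (Fin m) n → Set
CoverOK []            _        c = ⊤
CoverOK (_ ∷ _)       []       c = ⊤
CoverOK ((u , v) ∷ es) (σ ∷ σs) c =
  (¬ (lookup σ (lookup c u) ≡ lookup c v)) × CoverOK es σs c

coverOK? : ∀ {n m} (es : List (Fin n × Fin n)) (σs : List (Vec (Fin m) m)) →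
           Decidable (CoverOK {n} {m} es σs)
coverOK? []             _        c = yes tt
coverOK? (_ ∷ _)        []       c = yes tt
coverOK? ((u , v) ∷ es) (σ ∷ σs) c =
  ¬? (lookup σ (lookup c u) ≟ lookup c v) ×-dec coverOK? es σs c

PDPcover : ∀ {n} (G : Multigraph n) (m : ℕ) → Cover (length (edges G)) m → ℕ
PDPcover {n} G m σs = count (coverOK? (edges G) (toList σs)) (allVecs m n)

PDP : ∀ {n} → Multigraph n → ℕ → ℕ
PDP G m = minList (map (PDPcover G m) (allCovers (length (edges G)) m))

{-# OPTIONS --safe #-}
-- For a single edge uv and any matching σ, the colourings c of the n + 1 vertices with
-- σ (c u) = c v number at most m ^ n, since c v is then a function of the other n entries.
-- A union bound over the edges gives m ^ (n + 1) - |E| m ^ n ≤ P_DP(G, H) ≤ m ^ (n + 1)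
-- for every full m-fold cover H. The cover all of whose matchings are the identity has
-- exactly the proper colourings as its colourings, so P_DP(G, m) ≤ P(G, m) ≤ m ^ (n + 1),
-- and the difference is at most |E| m ^ n.
module Submission where

open import Defs
open import Data.Nat using (ℕ; suc; _*_; _^_; _≤_; ∣_-_∣)
open import Data.Product using (∃-syntax)

open import Level using (0ℓ)
open import Data.Nat using (zero; _+_; _∸_; z≤n; s≤s)
open import Data.Nat.Properties hiding (_≟_)
open import Data.Nat.ListAction using (sum)
open import Data.Fin using (Fin; zero; suc; punchOut)
open import Data.Fin.Properties using (_≟_)
open import Data.List as List using (List; []; _∷_; length; map; concatMap; allFin; _++_)
open import Data.List.Properties
  using (length-filter; filter-all; filter-≐; filter-++; length-++; length-map; length-tabulate; map-cong)
open import Data.List.Relation.Unary.All as All using (All; []; _∷_)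
open import Data.List.Relation.Unary.Any using (here; there)
open import Data.List.Relation.Unary.AllPairs using (_∷_)
open import Data.List.Relation.Unary.Unique.Propositional using (Unique)
open import Data.List.Relation.Unary.Unique.Propositional.Properties using (allFin⁺)
open import Data.List.Membership.Propositional using (_∈_)
open import Data.List.Membership.Propositional.Properties
  using (∈-map⁺; ∈-map⁻; ∈-concat⁺′; ∈-filter⁺; ∈-allFin)
open import Data.Vec as Vec using (Vec; []; _∷_; lookup; toList; removeAt)
open import Data.Vec.Properties using (removeAt-punchOut; lookup-allFin)
open import Data.Product using (_×_; _,_; proj₁; proj₂; map₂)
open import Data.Sum using (inj₁; inj₂)
open import Data.Unit using (tt)
open import Function using (_∘_; id)
open import Relation.Binary.Definitions using (DecidableEquality)
open import Relation.Binary.PropositionalEquality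
open import Relation.Nullary using (¬_; yes; no; contradiction)
open import Relation.Unary using (Pred; Decidable; _≐_)

module _ {A : Set} where

  count-universal : {P : Pred A 0ℓ} (P? : Decidable P) → (∀ x → P x) →
                    (xs : List A) → count P? xs ≡ length xs
  count-universal P? p xs = cong length (filter-all P? (All.universal p xs))

  count-≐ : {P Q : Pred A 0ℓ} (P? : Decidable P) (Q? : Decidable Q) → P ≐ Q →
            (xs : List A) → count P? xs ≡ count Q? xs
  count-≐ P? Q? P≐Q xs = cong length (filter-≐ P? Q? P≐Q xs)

  count-++ : {P : Pred A 0ℓ} (P? : Decidable P) (xs ys : List A) →
             count P? (xs ++ ys) ≡ count P? xs + count P? ys
  count-++ P? xs ys = trans (cong length (filter-++ P? xs ys)) (length-++ (List.filter P? xs))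

  count-split : {P Q R : Pred A 0ℓ} (P? : Decidable P) (Q? : Decidable Q) (R? : Decidable R) →
                (∀ x → P x → ¬ R x → Q x) →
                (xs : List A) → count P? xs ≤ count Q? xs + count R? xs
  count-split P? Q? R? h [] = z≤n
  count-split P? Q? R? h (x ∷ xs) with ih ← count-split P? Q? R? h xs | P? x | Q? x | R? x
  ... | yes p | no ¬q | no ¬r = contradiction (h x p ¬r) ¬q
  ... | yes _ | yes _ | no _  = s≤s ih
  ... | yes _ | yes _ | yes _ = s≤s (≤-trans ih (+-monoʳ-≤ (count Q? xs) (n≤1+n _)))
  ... | yes _ | no _  | yes _ = ≤-trans (s≤s ih) (≤-reflexive (sym (+-suc _ _)))
  ... | no _  | no _  | no _  = ih
  ... | no _  | yes _ | no _  = m≤n⇒m≤1+n ih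
  ... | no _  | no _  | yes _ = ≤-trans ih (+-monoʳ-≤ (count Q? xs) (n≤1+n _))
  ... | no _  | yes _ | yes _ = m≤n⇒m≤1+n (≤-trans ih (+-monoʳ-≤ (count Q? xs) (n≤1+n _)))

  count-disjoint : {P Q R : Pred A 0ℓ} (P? : Decidable P) (Q? : Decidable Q) (R? : Decidable R) →
                   (∀ x → P x → R x) → (∀ x → Q x → R x) → (∀ x → P x → ¬ Q x) →
                   (xs : List A) → count P? xs + count Q? xs ≤ count R? xs
  count-disjoint P? Q? R? P⊆R Q⊆R P∩Q=∅ [] = z≤n
  count-disjoint P? Q? R? P⊆R Q⊆R P∩Q=∅ (x ∷ xs)
    with ih ← count-disjoint P? Q? R? P⊆R Q⊆R P∩Q=∅ xs | P? x | Q? x | R? x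
  ... | yes p | yes q | _     = contradiction q (P∩Q=∅ x p)
  ... | yes p | no _  | no ¬r = contradiction (P⊆R x p) ¬r
  ... | no _  | yes q | no ¬r = contradiction (Q⊆R x q) ¬r
  ... | yes _ | no _  | yes _ = s≤s ih
  ... | no _  | yes _ | yes _ = ≤-trans (≤-reflexive (+-suc _ _)) (s≤s ih)
  ... | no _  | no _  | yes _ = m≤n⇒m≤1+n ih
  ... | no _  | no _  | no _  = ih

module _ {A B : Set} {P : Pred A 0ℓ} (P? : Decidable P) where

  count-map : (f : B → A) (xs : List B) → count P? (map f xs) ≡ count (P? ∘ f) xs
  count-map f []       = refl
  count-map f (x ∷ xs) with P? (f x)
  ... | yes _ = cong suc (count-map f xs)
  ... | no _  = count-map f xs

  count-concatMap : (f : B → List A) (xs : List B) →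
                    count P? (concatMap f xs) ≡ sum (map (count P? ∘ f) xs)
  count-concatMap f []       = refl
  count-concatMap f (x ∷ xs) =
    trans (count-++ P? (f x) (concatMap f xs)) (cong (count P? (f x) +_) (count-concatMap f xs))

module _ {B C : Set} (_≟ᴮ_ : DecidableEquality B) (g : C → B) where
  open import Data.List.Membership.DecPropositional _≟ᴮ_ using (_∈?_)

  sum-count-fibres : ∀ {bs} → Unique bs → (cs : List C) →
                     sum (map (λ b → count (λ c → b ≟ᴮ g c) cs) bs) ≤ count (λ c → g c ∈? bs) cs
  sum-count-fibres {[]}     _             cs = z≤n
  sum-count-fibres {b ∷ bs} (b∉bs ∷ uniq) cs =
    ≤-trans (+-monoʳ-≤ (count (λ c → b ≟ᴮ g c) cs) (sum-count-fibres uniq cs))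
      (count-disjoint (λ c → b ≟ᴮ g c) (λ c → g c ∈? bs) (λ c → g c ∈? (b ∷ bs))
        (λ c b≡gc → here (sym b≡gc)) (λ c → there)
        (λ c b≡gc gc∈bs → All.lookup b∉bs (subst (_∈ bs) (sym b≡gc) gc∈bs) refl) cs)

module _ {B : Set} where

  sum-map-≤ : (f : B → ℕ) {k : ℕ} → (∀ x → f x ≤ k) → (xs : List B) → sum (map f xs) ≤ length xs * k
  sum-map-≤ f f≤k []       = z≤n
  sum-map-≤ f f≤k (x ∷ xs) = +-mono-≤ (f≤k x) (sum-map-≤ f f≤k xs)

  sum-map-const : (k : ℕ) (xs : List B) → sum (map (λ _ → k) xs) ≡ length xs * k
  sum-map-const k []       = refl
  sum-map-const k (x ∷ xs) = cong (k +_) (sum-map-const k xs)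

  length-concatMap : {A : Set} (f : B → List A) (xs : List B) →
                     length (concatMap f xs) ≡ sum (map (length ∘ f) xs)
  length-concatMap f []       = refl
  length-concatMap f (x ∷ xs) = trans (length-++ (f x)) (cong (length (f x) +_) (length-concatMap f xs))

length-allFin : ∀ m → length (allFin m) ≡ m
length-allFin m = length-tabulate {n = m} id

length-allVecs : ∀ m N → length (allVecs m N) ≡ m ^ N
length-allVecs m zero    = refl
length-allVecs m (suc N) = begin
  length (allVecs m (suc N))
    ≡⟨ length-concatMap (λ x → map (x ∷_) (allVecs m N)) (allFin m) ⟩
  sum (map (λ x → length (map (x ∷_) (allVecs m N))) (allFin m))
    ≡⟨ cong sum (map-cong (λ x → trans (length-map (x ∷_) (allVecs m N)) (length-allVecs m N)) (allFin m)) ⟩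
  sum (map (λ _ → m ^ N) (allFin m))
    ≡⟨ sum-map-const (m ^ N) (allFin m) ⟩
  length (allFin m) * m ^ N
    ≡⟨ cong (_* m ^ N) (length-allFin m) ⟩
  m * m ^ N ∎
  where open ≡-Reasoning

count-allVecs-universal : ∀ {m N} {P : Pred (Vec (Fin m) N) 0ℓ} (P? : Decidable P) →
  (∀ c → P c) → count P? (allVecs m N) ≡ m ^ N
count-allVecs-universal {m} {N} P? p = trans (count-universal P? p (allVecs m N)) (length-allVecs m N)

∈-allVecs : ∀ {m N} (c : Vec (Fin m) N) → c ∈ allVecs m N
∈-allVecs []      = here refl
∈-allVecs (x ∷ c) = ∈-concat⁺′ (∈-map⁺ (x ∷_) (∈-allVecs c)) (∈-map⁺ _ (∈-allFin x))

count-allVecs-suc : ∀ {m N} {P : Pred (Vec (Fin m) (suc N)) 0ℓ} (P? : Decidable P) →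
  count P? (allVecs m (suc N)) ≡ sum (map (λ x → count (P? ∘ (x ∷_)) (allVecs m N)) (allFin m))
count-allVecs-suc {m} {N} P? =
  trans (count-concatMap P? (λ x → map (x ∷_) (allVecs m N)) (allFin m))
        (cong sum (map-cong (λ x → count-map P? (x ∷_) (allVecs m N)) (allFin m)))

count-lookup≡removeAt : ∀ m N (v : Fin (suc N)) (g : Vec (Fin m) N → Fin m) →
  count (λ c → lookup c v ≟ g (removeAt c v)) (allVecs m (suc N)) ≤ m ^ N
count-lookup≡removeAt m N zero g = begin
  count (λ c → lookup c zero ≟ g (removeAt c zero)) (allVecs m (suc N))
    ≡⟨ count-allVecs-suc (λ c → lookup c zero ≟ g (removeAt c zero)) ⟩
  sum (map (λ x → count (λ c → x ≟ g c) (allVecs m N)) (allFin m))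
    ≤⟨ sum-count-fibres _≟_ g (allFin⁺ m) (allVecs m N) ⟩
  count _ (allVecs m N)
    ≤⟨ length-filter _ (allVecs m N) ⟩
  length (allVecs m N)
    ≡⟨ length-allVecs m N ⟩
  m ^ N ∎
  where open ≤-Reasoning
count-lookup≡removeAt m (suc N) (suc v) g = begin
  count (λ c → lookup c (suc v) ≟ g (removeAt c (suc v))) (allVecs m (suc (suc N)))
    ≡⟨ count-allVecs-suc (λ c → lookup c (suc v) ≟ g (removeAt c (suc v))) ⟩
  sum (map (λ x → count (λ c → lookup c v ≟ g (removeAt (x ∷ c) (suc v))) (allVecs m (suc N))) (allFin m))
    ≤⟨ sum-map-≤ _ fibre-bound (allFin m) ⟩
  length (allFin m) * m ^ N
    ≡⟨ cong (_* m ^ N) (length-allFin m) ⟩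
  m * m ^ N ∎
  where
  open ≤-Reasoning
  fibre-bound : ∀ x → count (λ c → lookup c v ≟ g (removeAt (x ∷ c) (suc v))) (allVecs m (suc N)) ≤ m ^ N
  fibre-bound x = ≤-trans
    (≤-reflexive (count-≐ _ _ ((λ { {_ ∷ _} p → p }) , (λ { {_ ∷ _} p → p })) (allVecs m (suc N))))
    (count-lookup≡removeAt m N v (g ∘ (x ∷_)))

count-matched-≤ : ∀ {m n} {u v : Fin (suc n)} → u ≢ v → (f : Fin m → Fin m) →
  count (λ c → f (lookup c u) ≟ lookup c v) (allVecs m (suc n)) ≤ m ^ n
count-matched-≤ {m} {n} {u} {v} u≢v f = ≤-trans
  (≤-reflexive (count-≐ (λ c → f (lookup c u) ≟ lookup c v) (λ c → lookup c v ≟ g (removeAt c v))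
                        ((λ {c} → matched⇒determined c) , (λ {c} → determined⇒matched c)) (allVecs m (suc n))))
  (count-lookup≡removeAt m n v g)
  where
  v≢u : v ≢ u
  v≢u = u≢v ∘ sym
  g : Vec (Fin m) n → Fin m
  g r = f (lookup r (punchOut v≢u))
  matched⇒determined : ∀ c → f (lookup c u) ≡ lookup c v → lookup c v ≡ g (removeAt c v)
  matched⇒determined c eq = sym (trans (cong f (removeAt-punchOut c v≢u)) eq)
  determined⇒matched : ∀ c → lookup c v ≡ g (removeAt c v) → f (lookup c u) ≡ lookup c v
  determined⇒matched c eq = sym (trans eq (cong f (removeAt-punchOut c v≢u)))

coverOK-count-≥ : ∀ {m n} (es : List (Fin (suc n) × Fin (suc n))) (σs : List (Vec (Fin m) m)) →
  All (λ e → proj₁ e ≢ proj₂ e) es →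
  m ^ suc n ≤ count (coverOK? es σs) (allVecs m (suc n)) + length es * m ^ n
-- CoverOK imposes nothing once the list of matchings runs out.
coverOK-count-≥ [] σs _ =
  ≤-trans (≤-reflexive (sym (count-allVecs-universal (coverOK? [] σs) (λ _ → tt)))) (m≤m+n _ _)
coverOK-count-≥ {m} es@(_ ∷ _) [] _ =
  ≤-trans (≤-reflexive (sym (count-allVecs-universal (coverOK? {m = m} es []) (λ _ → tt)))) (m≤m+n _ _)
coverOK-count-≥ {m} {n} ((u , v) ∷ es) (σ ∷ σs) (u≢v ∷ loopless) = begin
  m ^ suc n
    ≤⟨ coverOK-count-≥ es σs loopless ⟩
  count (coverOK? es σs) cs + k * m ^ n
    ≤⟨ +-monoˡ-≤ (k * m ^ n) (count-split (coverOK? es σs) ok? matched? (λ c ok ¬matched → ¬matched , ok) cs) ⟩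
  count ok? cs + count matched? cs + k * m ^ n
    ≤⟨ +-monoˡ-≤ (k * m ^ n) (+-monoʳ-≤ (count ok? cs) (count-matched-≤ u≢v (lookup σ))) ⟩
  count ok? cs + m ^ n + k * m ^ n
    ≡⟨ +-assoc (count ok? cs) (m ^ n) (k * m ^ n) ⟩
  count ok? cs + (m ^ n + k * m ^ n) ∎
  where
  open ≤-Reasoning
  k = length es
  cs = allVecs m (suc n)
  ok? = coverOK? ((u , v) ∷ es) (σ ∷ σs)
  matched? = λ (c : Vec (Fin m) (suc n)) → lookup σ (lookup c u) ≟ lookup c v

toList-tabulate : ∀ {A : Set} {n} (f : Fin n → A) → toList (Vec.tabulate f) ≡ List.tabulate f
toList-tabulate {n = zero}  f = refl
toList-tabulate {n = suc n} f = cong (f zero ∷_) (toList-tabulate (f ∘ suc))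

allFin-isPerm : ∀ m → IsPerm (Vec.allFin m)
allFin-isPerm m = subst Unique (sym (toList-tabulate id)) (allFin⁺ m)

identityCover : ∀ k m → Cover k m
identityCover k m = Vec.replicate k (Vec.allFin m)

identityCover∈allCovers : ∀ k m → identityCover k m ∈ allCovers k m
identityCover∈allCovers zero    m = here refl
identityCover∈allCovers (suc k) m =
  ∈-concat⁺′ (∈-map⁺ (Vec.allFin m ∷_) (identityCover∈allCovers k m))
             (∈-map⁺ _ (∈-filter⁺ isPerm? (∈-allVecs (Vec.allFin m)) (allFin-isPerm m)))

module _ {n m : ℕ} {c : Vec (Fin m) n} where

  proper⇒coverOK-identity : (es : List (Fin n × Fin n)) →
    All (λ e → lookup c (proj₁ e) ≢ lookup c (proj₂ e)) es →
    CoverOK es (toList (identityCover (length es) m)) c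
  proper⇒coverOK-identity []             []              = tt
  proper⇒coverOK-identity ((u , v) ∷ es) (cu≢cv ∷ proper) =
    cu≢cv ∘ trans (sym (lookup-allFin (lookup c u))) , proper⇒coverOK-identity es proper

  coverOK-identity⇒proper : (es : List (Fin n × Fin n)) →
    CoverOK es (toList (identityCover (length es) m)) c →
    All (λ e → lookup c (proj₁ e) ≢ lookup c (proj₂ e)) es
  coverOK-identity⇒proper []             tt              = []
  coverOK-identity⇒proper ((u , v) ∷ es) (σcu≢cv , ok) =
    σcu≢cv ∘ trans (lookup-allFin (lookup c u)) ∷ coverOK-identity⇒proper es ok

P≡PDPcover-identityCover : ∀ {n} (G : Multigraph n) m →
  P G m ≡ PDPcover G m (identityCover (length (edges G)) m)
P≡PDPcover-identityCover {n} G m =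
  count-≐ (proper? G) (coverOK? (edges G) _)
    ((λ {c} → proper⇒coverOK-identity (edges G)) , (λ {c} → coverOK-identity⇒proper (edges G)))
    (allVecs m n)

minList-≤ : ∀ {x xs} → x ∈ xs → minList xs ≤ x
minList-≤ {xs = _ ∷ []}    (here refl) = ≤-refl
minList-≤ {xs = _ ∷ _ ∷ _} (here refl) = m⊓n≤m _ _
minList-≤ {xs = _ ∷ _ ∷ _} (there x∈xs) = ≤-trans (m⊓n≤n _ _) (minList-≤ x∈xs)

minList-∈ : ∀ {x xs} → x ∈ xs → minList xs ∈ xs
minList-∈ {xs = _ ∷ []}     _ = here refl
minList-∈ {xs = y ∷ z ∷ xs} _ with ⊓-sel y (minList (z ∷ xs)) | minList-∈ {xs = z ∷ xs} (here refl)
... | inj₁ min≡y    | _     = here min≡y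
... | inj₂ min≡rest | rest∈ = there (subst (_∈ z ∷ xs) (sym min≡rest) rest∈)

module _ {n : ℕ} (G : Multigraph n) (m : ℕ) where

  P∈PDPcover-values : P G m ∈ map (PDPcover G m) (allCovers (length (edges G)) m)
  P∈PDPcover-values =
    subst (_∈ map (PDPcover G m) (allCovers (length (edges G)) m)) (sym (P≡PDPcover-identityCover G m))
      (∈-map⁺ (PDPcover G m) (identityCover∈allCovers (length (edges G)) m))

  PDP≤P : PDP G m ≤ P G m
  PDP≤P = minList-≤ P∈PDPcover-values

  PDP-attained : ∃[ H ] PDP G m ≡ PDPcover G m H
  PDP-attained = map₂ proj₂ (∈-map⁻ (PDPcover G m) (minList-∈ P∈PDPcover-values))

  P≤m^n : P G m ≤ m ^ n
  P≤m^n = ≤-trans (length-filter (proper? G) (allVecs m n)) (≤-reflexive (length-allVecs m n))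

PDP-≥ : ∀ {n} (G : Multigraph (suc n)) m → m ^ suc n ≤ PDP G m + length (edges G) * m ^ n
PDP-≥ G m with H , PDP≡ ← PDP-attained G m =
  subst (λ p → _ ≤ p + _) (sym PDP≡) (coverOK-count-≥ (edges G) (toList H) (loopless G))

n≤m≤t≤n+o⇒∣m-n∣≤o : ∀ {m n t o} → n ≤ m → m ≤ t → t ≤ n + o → ∣ m - n ∣ ≤ o
n≤m≤t≤n+o⇒∣m-n∣≤o {m} {n} {t} {o} n≤m m≤t t≤n+o = begin
  ∣ m - n ∣ ≡⟨ m≤n⇒∣n-m∣≡n∸m n≤m ⟩
  m ∸ n     ≤⟨ ∸-monoˡ-≤ n m≤t ⟩
  t ∸ n     ≤⟨ m≤n+o⇒m∸n≤o t n t≤n+o ⟩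
  o         ∎
  where open ≤-Reasoning

theorem18 : ∀ (n : ℕ) (G : Multigraph (suc n)) →
    ∃[ C ] ∃[ M ] ∀ (m : ℕ) → M ≤ m → ∣ P G m - PDP G m ∣ ≤ C * m ^ n
theorem18 n G = length (edges G) , 0 , λ m _ →
  n≤m≤t≤n+o⇒∣m-n∣≤o (PDP≤P G m) (P≤m^n G m) (PDP-≥ G m)
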